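{- Let $g,v\ge1$ and $w\ge0$ be integers. Let $(a,b)$ be a Golay pair of length $g$ and let $(c,d)$ be a pair of ternary sequences of length $v$. Represent sequences $s=(s_0,\dots,s_{n-1})$ by polynomials $s(z)=\sum_i s_iz^i$, and define sequences $e,f$ of length $gv$ by $$e(z)=\tfrac12(a(z)+b(z))c(z^g)+\tfrac12(a(z)-b(z))d(z^{ -g})z^{gv-g},$$ $$f(z)=\tfrac12(b(z)-a(z))c(z^{ -g})z^{gv-g}+\tfrac12(a(z)+b(z))d(z^g).$$ Then $e,f$ are ternary sequences of length $gv$, and: (i) if $(c,d)$ is a periodic complementary ternary pair of length $v$ and total weight $w$, then $(e,f)$ is a periodic complementary ternary pair of length $gv$ and total weight $gw$; (ii) if $(c,d)$ is a negaperiodic complementary ternary pair of length $v$ and total weight $w$, then $(e,f)$ is a negaperiodic complementary ternary pair of length $gv$ and total weight $gw$.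
   Context: A sequence is binary if its entries lie in $\{\pm1\}$ and ternary if they lie in $\{0,\pm1\}$. For a sequence $a=(a_0,\dots,a_{n-1})$ define $\mathrm{AF}_a(k)=\sum_{i=0}^{n-k-1}a_ia_{i+k}$ (with $a_i=0$ outside $0\le i<n$), $\mathrm{PAF}_a(k)=a\cdot aP^k$ and $\mathrm{NAF}_a(k)=a\cdot aN^k$, where $P$ and $N$ are the $n\times n$ cyclic and negacyclic shift matrices ($P_{i,i+1}=N_{i,i+1}=1$ for $0\le i\le n-2$, $P_{n-1,0}=1$, $N_{n-1,0}=-1$, other entries $0$). A Golay pair of length $g$ is a pair of binary sequences $(a,b)$ of length $g$ with $\mathrm{AF}_a(k)+\mathrm{AF}_b(k)=0$ for all $k\neq0$. A periodic (resp. negaperiodic) complementary ternary pair of length $n$ is a pair $(c,d)$ of ternary sequences of length $n$ with $\mathrm{PAF}_c(k)+\mathrm{PAF}_d(k)=0$ (resp. $\mathrm{NAF}_c(k)+\mathrm{NAF}_d(k)=0$) for $0<k<n$; its total weight is the total number of nonzero entries of $c$ and $d$. -}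

module Defs where

open import Data.Nat as ℕ using (ℕ; zero; suc; _∸_; _<?_)
open import Data.Fin using (Fin; zero; suc; toℕ; fromℕ<)
open import Data.Integer using (ℤ; 0ℤ; 1ℤ; -1ℤ; _+_; _*_; _-_)
open import Data.Integer.DivMod using () renaming (_/_ to _divZ_)
open import Data.Bool using (if_then_else_; _∧_)
open import Data.Product using (_×_)
open import Data.Sum using (_⊎_)
open import Relation.Nullary using (does; yes; no)
open import Relation.Binary.PropositionalEquality using (_≡_)

Seq : ℕ → Set
Seq n = Fin n → ℤ

sumFin : ∀ {n} → (Fin n → ℤ) → ℤ
sumFin {zero}  f = 0ℤ
sumFin {suc n} f = f zero + sumFin (λ i → f (suc i))

countFin : ∀ {n} → (Fin n → ℕ) → ℕ
countFin {zero}  f = 0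
countFin {suc n} f = f zero ℕ.+ countFin (λ i → f (suc i))

Binary : ∀ {n} → Seq n → Set
Binary a = ∀ i → a i ≡ 1ℤ ⊎ a i ≡ -1ℤ

Ternary : ∀ {n} → Seq n → Set
Ternary a = ∀ i → a i ≡ 0ℤ ⊎ a i ≡ 1ℤ ⊎ a i ≡ -1ℤ

weight : ∀ {n} → Seq n → ℕ
weight a = countFin (λ i → if does (Data.Integer._≟_ (a i) 0ℤ) then 0 else 1)

ext : ∀ {n} → Seq n → ℕ → ℤ
ext {n} a k with k <? n
... | yes p = a (fromℕ< p)
... | no _  = 0ℤ

AF : ∀ {n} → Seq n → ℕ → ℤ
AF a k = sumFin (λ i → a i * ext a (toℕ i ℕ.+ k))

GolayPair : ∀ {g} → Seq g → Seq g → Set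
GolayPair a b = Binary a × Binary b × (∀ k → 1 ℕ.≤ k → AF a k + AF b k ≡ 0ℤ)

Mat : ℕ → Set
Mat n = Fin n → Fin n → ℤ

_·ᴹ_ : ∀ {n} → Seq n → Mat n → Seq n
(x ·ᴹ M) j = sumFin (λ i → x i * M i j)

dot : ∀ {n} → Seq n → Seq n → ℤ
dot x y = sumFin (λ i → x i * y i)

powMul : ∀ {n} → Seq n → Mat n → ℕ → Seq n
powMul x M zero    = x
powMul x M (suc k) = powMul x M k ·ᴹ M

eqℕ : ℕ → ℕ → Data.Bool.Bool
eqℕ x y = does (x ℕ.≟ y)

Pmat : (n : ℕ) → Mat n
Pmat n i j =
  if eqℕ (suc (toℕ i)) (toℕ j) then 1ℤ
  else if eqℕ (suc (toℕ i)) n ∧ eqℕ (toℕ j) 0 then 1ℤ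
  else 0ℤ

Nmat : (n : ℕ) → Mat n
Nmat n i j =
  if eqℕ (suc (toℕ i)) (toℕ j) then 1ℤ
  else if eqℕ (suc (toℕ i)) n ∧ eqℕ (toℕ j) 0 then -1ℤ
  else 0ℤ

PAF : ∀ {n} → Seq n → ℕ → ℤ
PAF {n} a k = dot a (powMul a (Pmat n) k)

NAF : ∀ {n} → Seq n → ℕ → ℤ
NAF {n} a k = dot a (powMul a (Nmat n) k)

PeriodicCTP : ∀ {n} → Seq n → Seq n → ℕ → Set
PeriodicCTP {n} c d w =
  Ternary c × Ternary d ×
  (∀ k → 0 ℕ.< k → k ℕ.< n → PAF c k + PAF d k ≡ 0ℤ) ×
  weight c ℕ.+ weight d ≡ w

NegaperiodicCTP : ∀ {n} → Seq n → Seq n → ℕ → Set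
NegaperiodicCTP {n} c d w =
  Ternary c × Ternary d ×
  (∀ k → 0 ℕ.< k → k ℕ.< n → NAF c k + NAF d k ≡ 0ℤ) ×
  weight c ℕ.+ weight d ≡ w

-- Polynomial products, coefficientwise.
-- h : length g, c : length v.
-- coefficients (of z^t, 0 ≤ t < gv) of h(z) c(z^g)
polyZg : ∀ {g v} → Seq g → Seq v → Seq (g ℕ.* v)
polyZg {g} {v} h c t =
  sumFin (λ i → sumFin (λ j →
    if eqℕ (toℕ i ℕ.+ g ℕ.* toℕ j) (toℕ t) then h i * c j else 0ℤ))

-- coefficients (of z^t, 0 ≤ t < gv) of h(z) c(z^{-g}) z^{gv-g}
-- (the monomial c_j z^{-gj} z^{gv-g} = c_j z^{g(v-1-j)})
polyZmg : ∀ {g v} → Seq g → Seq v → Seq (g ℕ.* v)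
polyZmg {g} {v} h c t =
  sumFin (λ i → sumFin (λ j →
    if eqℕ (toℕ i ℕ.+ g ℕ.* (v ∸ 1 ∸ toℕ j)) (toℕ t) then h i * c j else 0ℤ))

-- ½(a+b), ½(a-b), ½(b-a) (exact halves, since a, b are binary)
half : ℤ → ℤ
half x = x divZ (Data.Integer.+ 2)

hsum hdiff hdiff' : ∀ {g} → Seq g → Seq g → Seq g
hsum a b i = half (a i + b i)
hdiff a b i = half (a i - b i)
hdiff' a b i = half (b i - a i)

_⊕_ : ∀ {n} → Seq n → Seq n → Seq n
(x ⊕ y) i = x i + y i

seqE : ∀ {g v} → Seq g → Seq g → Seq v → Seq v → Seq (g ℕ.* v)
seqE a b c d = polyZg (hsum a b) c ⊕ polyZmg (hdiff a b) d

seqF : ∀ {g v} → Seq g → Seq g → Seq v → Seq v → Seq (g ℕ.* v)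
seqF a b c d = polyZmg (hdiff' a b) c ⊕ polyZg (hsum a b) d

module Submission where

-- For a sign ε
-- the twisted correlation corr ε n x y k = ∑_{j<n} x_j ỹ_{j+k} uses the
-- extension ỹ_{n+m} = ε·y_m.  The cyclic (ε = 1) and negacyclic (ε = -1) shift
-- matrices realise it: PAF/NAF at lag k is ε·corr at lag n-k, so both parts of
-- the proposition are one statement.  The coefficients of h(z)c(z^g) and
-- h(z)c(z^{-g})z^{gv-g} form Kronecker sequences, and corr-kron splits their
-- correlation at lag gQ+r into aperiodic correlations of the short factors
-- times correlations of the long ones at lags Q and Q+1.  For s = ½(a+b) and
-- t = ½(a-b) the Golay property kills the short parts at r > 0, a reversal
-- symmetry cancels the cross terms of e and f, and the hypothesis on (c,d)
-- handles r = 0.  Ternarity and the weight count hold since at each index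
-- exactly one of s_i, t_i is ±1 and the other is 0.

open import Defs
open import Data.Nat using (ℕ; zero; suc; _+_; _*_; _∸_; _≤_; _<_; z≤n; s≤s; NonZero; _<?_)
open import Data.Product using (_×_; _,_; proj₁; proj₂)
import Data.Nat as ℕ
import Data.Nat.Properties as NP
open import Data.Nat.DivMod using (_%_; _/_; m≡m%n+[m/n]*n; [m+kn]%n≡m%n; m<n⇒m%n≡m; m%n<n; m<n*o⇒m/o<n)
open import Data.Fin using (Fin; toℕ; fromℕ<)
import Data.Fin as Fin
open import Data.Fin.Properties using (toℕ<n; fromℕ<-toℕ; toℕ-fromℕ<)
open import Data.Integer using (ℤ; 0ℤ; 1ℤ; -1ℤ; -_)
  renaming (_+_ to _+ᶻ_; _*_ to _*ᶻ_; _-_ to _-ᶻ_)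
import Data.Integer as Z
import Data.Integer.Properties as ZP
open import Data.Integer.Tactic.RingSolver using (solve-∀)
open import Relation.Binary.PropositionalEquality
open import Relation.Nullary using (yes; no; does)
open import Relation.Nullary.Decidable using (dec-true; dec-false)
open import Data.Empty using (⊥-elim)
open import Data.Bool using (true; false; if_then_else_; _∧_)
open import Data.Bool.Properties using (∧-zeroʳ)
open import Data.Sum using (_⊎_; inj₁; inj₂)

Seq∞ : Set
Seq∞ = ℕ → ℤ

∑ : ℕ → Seq∞ → ℤ
∑ zero    f = 0ℤ
∑ (suc n) f = f 0 +ᶻ ∑ n (λ i → f (suc i))

∑-cong : ∀ n {f h : Seq∞} → (∀ i → i < n → f i ≡ h i) → ∑ n f ≡ ∑ n h
∑-cong zero    p = refl
∑-cong (suc n) p = cong₂ _+ᶻ_ (p 0 (s≤s z≤n)) (∑-cong n (λ i q → p (suc i) (s≤s q)))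

∑-length : ∀ {m n} (f : Seq∞) → m ≡ n → ∑ m f ≡ ∑ n f
∑-length f refl = refl

∑-zero : ∀ n {f : Seq∞} → (∀ i → i < n → f i ≡ 0ℤ) → ∑ n f ≡ 0ℤ
∑-zero zero    p = refl
∑-zero (suc n) p = cong₂ _+ᶻ_ (p 0 (s≤s z≤n)) (∑-zero n (λ i q → p (suc i) (s≤s q)))

∑-single : ∀ n {f : Seq∞} p → p < n → (∀ i → i < n → i ≢ p → f i ≡ 0ℤ) → ∑ n f ≡ f p
∑-single (suc n) {f} zero _ h =
  trans (cong (f 0 +ᶻ_) (∑-zero n (λ i q → h (suc i) (s≤s q) (λ ())))) (ZP.+-identityʳ (f 0))
∑-single (suc n) {f} (suc p) (s≤s p<n) h =
  trans (cong₂ _+ᶻ_ (h 0 (s≤s z≤n) (λ ()))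
                    (∑-single n p p<n (λ i q ne → h (suc i) (s≤s q) (λ e → ne (NP.suc-injective e)))))
        (ZP.+-identityˡ _)

∑-+ : ∀ n (f h : Seq∞) → ∑ n (λ i → f i +ᶻ h i) ≡ ∑ n f +ᶻ ∑ n h
∑-+ zero    f h = refl
∑-+ (suc n) f h rewrite ∑-+ n (λ i → f (suc i)) (λ i → h (suc i)) =
  interchange (f 0) (h 0) (∑ n (λ i → f (suc i))) (∑ n (λ i → h (suc i)))
  where
  interchange : ∀ a b c d → (a +ᶻ b) +ᶻ (c +ᶻ d) ≡ (a +ᶻ c) +ᶻ (b +ᶻ d)
  interchange = solve-∀

∑-*ˡ : ∀ n c (f : Seq∞) → ∑ n (λ i → c *ᶻ f i) ≡ c *ᶻ ∑ n f
∑-*ˡ zero    c f = sym (ZP.*-zeroʳ c)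
∑-*ˡ (suc n) c f rewrite ∑-*ˡ n c (λ i → f (suc i)) = sym (ZP.*-distribˡ-+ c (f 0) _)

∑-*ʳ : ∀ n c (f : Seq∞) → ∑ n (λ i → f i *ᶻ c) ≡ ∑ n f *ᶻ c
∑-*ʳ n c f = trans (∑-cong n (λ i _ → ZP.*-comm (f i) c)) (trans (∑-*ˡ n c f) (ZP.*-comm c _))

∑-neg : ∀ n (f : Seq∞) → ∑ n (λ i → - f i) ≡ - ∑ n f
∑-neg zero    f = refl
∑-neg (suc n) f rewrite ∑-neg n (λ i → f (suc i)) = sym (ZP.neg-distrib-+ (f 0) _)

∑-const : ∀ n c → ∑ n (λ _ → c) ≡ Z.+ n *ᶻ c
∑-const zero    c = sym (ZP.*-zeroˡ c)
∑-const (suc n) c rewrite ∑-const n c = step c (Z.+ n)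
  where
  step : ∀ c m → c +ᶻ m *ᶻ c ≡ (1ℤ +ᶻ m) *ᶻ c
  step = solve-∀

∑-snoc : ∀ n (f : Seq∞) → ∑ (suc n) f ≡ ∑ n f +ᶻ f n
∑-snoc zero    f = trans (ZP.+-identityʳ (f 0)) (sym (ZP.+-identityˡ (f 0)))
∑-snoc (suc n) f rewrite ∑-snoc n (λ i → f (suc i)) = sym (ZP.+-assoc (f 0) _ _)

∑-split : ∀ m n (f : Seq∞) → ∑ (m + n) f ≡ ∑ m f +ᶻ ∑ n (λ i → f (m + i))
∑-split zero    n f = sym (ZP.+-identityˡ _)
∑-split (suc m) n f rewrite ∑-split m n (λ i → f (suc i)) = sym (ZP.+-assoc (f 0) _ _)

∑-reverse : ∀ n (f : Seq∞) → ∑ n f ≡ ∑ n (λ i → f (n ∸ suc i))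
∑-reverse zero    f = refl
∑-reverse (suc n) f = begin
    ∑ (suc n) f                          ≡⟨ ∑-snoc n f ⟩
    ∑ n f +ᶻ f n                         ≡⟨ cong (_+ᶻ f n) (∑-reverse n f) ⟩
    ∑ n (λ i → f (n ∸ suc i)) +ᶻ f n     ≡⟨ ZP.+-comm _ (f n) ⟩
    f n +ᶻ ∑ n (λ i → f (n ∸ suc i))     ∎
  where open ≡-Reasoning

∑-blocks : ∀ g v (H : Seq∞) → ∑ (g * v) H ≡ ∑ v (λ j → ∑ g (λ i → H (g * j + i)))
∑-blocks g zero    H = ∑-length H (NP.*-zeroʳ g)
∑-blocks g (suc v) H = begin
    ∑ (g * suc v) H                                ≡⟨ ∑-length H (NP.*-suc g v) ⟩
    ∑ (g + g * v) H                                ≡⟨ ∑-split g (g * v) H ⟩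
    ∑ g H +ᶻ ∑ (g * v) (λ t → H (g + t))           ≡⟨ cong₂ _+ᶻ_ (∑-cong g (λ i _ → cong H (cong (_+ i) (sym (NP.*-zeroʳ g)))))
                                                                 (∑-blocks g v (λ t → H (g + t))) ⟩
    ∑ g (λ i → H (g * 0 + i)) +ᶻ ∑ v (λ j → ∑ g (λ i → H (g + (g * j + i))))
      ≡⟨ cong (∑ g (λ i → H (g * 0 + i)) +ᶻ_) (∑-cong v (λ j _ → ∑-cong g (λ i _ → cong H (next-block j i)))) ⟩
    ∑ (suc v) (λ j → ∑ g (λ i → H (g * j + i)))    ∎
  where
  open ≡-Reasoning
  next-block : ∀ j i → g + (g * j + i) ≡ g * suc j + i
  next-block j i = trans (sym (NP.+-assoc g (g * j) i)) (cong (_+ i) (sym (NP.*-suc g j)))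

∑∑-bilinear : ∀ g v (a c b d : Seq∞) →
  ∑ v (λ j → ∑ g (λ i → a i *ᶻ b j +ᶻ c i *ᶻ d j)) ≡ ∑ g a *ᶻ ∑ v b +ᶻ ∑ g c *ᶻ ∑ v d
∑∑-bilinear g v a c b d = begin
    ∑ v (λ j → ∑ g (λ i → a i *ᶻ b j +ᶻ c i *ᶻ d j))
      ≡⟨ ∑-cong v (λ j _ → trans (∑-+ g (λ i → a i *ᶻ b j) (λ i → c i *ᶻ d j))
                                   (cong₂ _+ᶻ_ (∑-*ʳ g (b j) a) (∑-*ʳ g (d j) c))) ⟩
    ∑ v (λ j → ∑ g a *ᶻ b j +ᶻ ∑ g c *ᶻ d j)
      ≡⟨ ∑-+ v _ _ ⟩
    ∑ v (λ j → ∑ g a *ᶻ b j) +ᶻ ∑ v (λ j → ∑ g c *ᶻ d j)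
      ≡⟨ cong₂ _+ᶻ_ (∑-*ˡ v (∑ g a) b) (∑-*ˡ v (∑ g c) d) ⟩
    ∑ g a *ᶻ ∑ v b +ᶻ ∑ g c *ᶻ ∑ v d ∎
  where open ≡-Reasoning

sumFin≡∑ : ∀ n {f : Fin n → ℤ} {h : Seq∞} → (∀ i → f i ≡ h (toℕ i)) → sumFin f ≡ ∑ n h
sumFin≡∑ zero    p = refl
sumFin≡∑ (suc n) p = cong₂ _+ᶻ_ (p Fin.zero) (sumFin≡∑ n (λ i → p (Fin.suc i)))

countFin≡sumFin : ∀ n (f : Fin n → ℕ) → Z.+ countFin f ≡ sumFin (λ i → Z.+ f i)
countFin≡sumFin zero    f = refl
countFin≡sumFin (suc n) f =
  trans (ZP.pos-+ (f Fin.zero) _) (cong (Z.+ f Fin.zero +ᶻ_) (countFin≡sumFin n (λ i → f (Fin.suc i))))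

ext-fromℕ< : ∀ {n} (a : Seq n) {m} (p : m < n) → ext a m ≡ a (fromℕ< p)
ext-fromℕ< {n} a {m} p with m <? n
... | yes q = cong (λ z → a (fromℕ< z)) (NP.<-irrelevant q p)
... | no q  = ⊥-elim (q p)

ext-toℕ : ∀ {n} (a : Seq n) (i : Fin n) → ext a (toℕ i) ≡ a i
ext-toℕ a i = trans (ext-fromℕ< a (toℕ<n i)) (cong a (fromℕ<-toℕ i (toℕ<n i)))

_≈ₛ_ : ∀ {n} → Seq n → Seq∞ → Set
y ≈ₛ Y = ∀ i → y i ≡ Y (toℕ i)

≈ₛ-ext : ∀ {n} {y : Seq n} {Y : Seq∞} → y ≈ₛ Y → ∀ t → t < n → ext y t ≡ Y t
≈ₛ-ext {y = y} {Y} r t p = trans (ext-fromℕ< y p) (trans (r (fromℕ< p)) (cong Y (toℕ-fromℕ< p)))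

≈ₛ-trans : ∀ {n} {y : Seq n} {Y Y' : Seq∞} → y ≈ₛ Y → (∀ t → t < n → Y t ≡ Y' t) → y ≈ₛ Y'
≈ₛ-trans r h i = trans (r i) (h (toℕ i) (toℕ<n i))

eqℕ-yes : ∀ {m n} → m ≡ n → eqℕ m n ≡ true
eqℕ-yes {m} {n} = dec-true (m ℕ.≟ n)

eqℕ-no : ∀ {m n} → m ≢ n → eqℕ m n ≡ false
eqℕ-no {m} {n} = dec-false (m ℕ.≟ n)

block-rem : ∀ g .{{_ : NonZero g}} j i → i < g → (g * j + i) % g ≡ i
block-rem g j i i<g =
  trans (cong (_% g) (trans (NP.+-comm (g * j) i) (cong (i +_) (NP.*-comm g j))))
        (trans ([m+kn]%n≡m%n i j g) (m<n⇒m%n≡m i<g))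

block-quot : ∀ g .{{_ : NonZero g}} j i → i < g → (g * j + i) / g ≡ j
block-quot g j i i<g = sym (NP.*-cancelʳ-≡ j ((g * j + i) / g) g (NP.+-cancelˡ-≡ i _ _ e))
  where
  e : i + j * g ≡ i + (g * j + i) / g * g
  e = trans (trans (NP.+-comm i (j * g)) (cong (_+ i) (NP.*-comm j g)))
        (trans (m≡m%n+[m/n]*n (g * j + i) g) (cong (_+ ((g * j + i) / g * g)) (block-rem g j i i<g)))

block-unique : ∀ g .{{_ : NonZero g}} {j i j' i'} → i < g → i' < g →
  g * j + i ≡ g * j' + i' → i ≡ i' × j ≡ j'
block-unique g {j} {i} {j'} {i'} p p' e =
  trans (sym (block-rem g j i p)) (trans (cong (_% g) e) (block-rem g j' i' p')) ,
  trans (sym (block-quot g j i p)) (trans (cong (_/ g) e) (block-quot g j' i' p'))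

block-decomp : ∀ g .{{_ : NonZero g}} v t → t < g * v →
  (t ≡ g * (t / g) + t % g) × t % g < g × t / g < v
block-decomp g v t t<gv =
  trans (m≡m%n+[m/n]*n t g) (trans (NP.+-comm (t % g) _) (cong (_+ (t % g)) (NP.*-comm (t / g) g))) ,
  m%n<n t g ,
  m<n*o⇒m/o<n (subst (t <_) (NP.*-comm g v) t<gv)

block-bound : ∀ g {v j i} → i < g → j < v → g * j + i < g * v
block-bound g {v} {j} {i} i<g j<v = NP.≤-trans (NP.+-monoʳ-< (g * j) i<g)
  (subst (_≤ g * v) (trans (NP.*-suc g j) (NP.+-comm g (g * j))) (NP.*-monoʳ-≤ g j<v))

∸-below : ∀ {m n} → m < n + n → n ≤ m → m ∸ n < n
∸-below {m} {n} m<2n n≤m = subst (m ∸ n <_) (NP.m+n∸n≡m n n) (NP.∸-monoˡ-< m<2n n≤m)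

twist : ℤ → ℕ → Seq∞ → Seq∞
twist ε n y m with m <? n
... | yes _ = y m
... | no _  = ε *ᶻ y (m ∸ n)

twist-below : ∀ ε n y {m} → m < n → twist ε n y m ≡ y m
twist-below ε n y {m} p with m <? n
... | yes _ = refl
... | no q  = ⊥-elim (q p)

twist-above : ∀ ε n y {m} → n ≤ m → twist ε n y m ≡ ε *ᶻ y (m ∸ n)
twist-above ε n y {m} p with m <? n
... | yes q = ⊥-elim (NP.<⇒≱ q p)
... | no _  = refl

corr : ℤ → ℕ → Seq∞ → Seq∞ → ℕ → ℤ
corr ε n x y k = ∑ n (λ j → x j *ᶻ twist ε n y (j + k))

twist-cong : ∀ ε n {y y' : Seq∞} m → m < n + n → (∀ t → t < n → y t ≡ y' t) →
  twist ε n y m ≡ twist ε n y' m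
twist-cong ε n m m<2n h with m <? n
... | yes p = h m p
... | no p  = cong (ε *ᶻ_) (h (m ∸ n) (∸-below m<2n (NP.≮⇒≥ p)))

corr-cong : ∀ ε n {x x' y y' : Seq∞} k → k ≤ n →
  (∀ t → t < n → x t ≡ x' t) → (∀ t → t < n → y t ≡ y' t) → corr ε n x y k ≡ corr ε n x' y' k
corr-cong ε n k k≤n hx hy =
  ∑-cong n (λ t t<n → cong₂ _*ᶻ_ (hx t t<n) (twist-cong ε n (t + k) (NP.+-mono-<-≤ t<n k≤n) hy))

_⊞_ : Seq∞ → Seq∞ → Seq∞
(f ⊞ h) i = f i +ᶻ h i

twist-⊞ : ∀ ε n f h m → twist ε n (f ⊞ h) m ≡ twist ε n f m +ᶻ twist ε n h m
twist-⊞ ε n f h m with m <? n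
... | yes _ = refl
... | no _  = ZP.*-distribˡ-+ ε (f (m ∸ n)) (h (m ∸ n))

corr-⊞ : ∀ ε n x y k → corr ε n (x ⊞ y) (x ⊞ y) k ≡
  (corr ε n x x k +ᶻ corr ε n x y k) +ᶻ (corr ε n y x k +ᶻ corr ε n y y k)
corr-⊞ ε n x y k = trans (corr-⊞ˡ x y (x ⊞ y)) (cong₂ _+ᶻ_ (corr-⊞ʳ x x y) (corr-⊞ʳ y x y))
  where
  corr-⊞ˡ : ∀ f h z → corr ε n (f ⊞ h) z k ≡ corr ε n f z k +ᶻ corr ε n h z k
  corr-⊞ˡ f h z = trans (∑-cong n (λ j _ → ZP.*-distribʳ-+ (twist ε n z (j + k)) (f j) (h j))) (∑-+ n _ _)
  corr-⊞ʳ : ∀ z f h → corr ε n z (f ⊞ h) k ≡ corr ε n z f k +ᶻ corr ε n z h k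
  corr-⊞ʳ z f h = trans (∑-cong n (λ j _ → trans (cong (z j *ᶻ_) (twist-⊞ ε n f h (j + k)))
                                                 (ZP.*-distribˡ-+ (z j) _ _))) (∑-+ n _ _)

-- The (p,q) entry of the shift matrix with corner entry ε; Pmat and Nmat are
-- the cases ε = 1 and ε = -1 (definitionally).
shiftEntry : ℤ → ℕ → ℕ → ℕ → ℤ
shiftEntry ε n p q = if eqℕ (suc p) q then 1ℤ else if eqℕ (suc p) n ∧ eqℕ q 0 then ε else 0ℤ

IsShift : ℤ → (∀ n → Mat n) → Set
IsShift ε M = ∀ n i j → M n i j ≡ shiftEntry ε n (toℕ i) (toℕ j)

-- The effect of one multiplication by the shift matrix, on a length-n sequence.
rotate : ℤ → ℕ → Seq∞ → Seq∞
rotate ε n X zero    = X (n ∸ 1) *ᶻ ε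
rotate ε n X (suc q) = X q *ᶻ 1ℤ

-- Entry q of X·M: only the row above q (or the corner row, for q = 0) contributes.
row-times-shift : ∀ ε n (X : Seq∞) q → q < n → ∑ n (λ p → X p *ᶻ shiftEntry ε n p q) ≡ rotate ε n X q
row-times-shift ε (suc n') X zero _ = trans (∑-single (suc n') n' NP.≤-refl off) (cong (X n' *ᶻ_) corner)
  where
  off : ∀ p → p < suc n' → p ≢ n' → X p *ᶻ shiftEntry ε (suc n') p 0 ≡ 0ℤ
  off p _ ne rewrite eqℕ-no {suc p} {0} (λ ()) | eqℕ-no {suc p} {suc n'} (λ e → ne (NP.suc-injective e)) =
    ZP.*-zeroʳ (X p)
  corner : shiftEntry ε (suc n') n' 0 ≡ ε
  corner rewrite eqℕ-no {suc n'} {0} (λ ()) | eqℕ-yes {suc n'} {suc n'} refl = refl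
row-times-shift ε n X (suc q) q<n = trans (∑-single n q (NP.<-trans (NP.n<1+n q) q<n) off) (cong (X q *ᶻ_) diag)
  where
  off : ∀ p → p < n → p ≢ q → X p *ᶻ shiftEntry ε n p (suc q) ≡ 0ℤ
  off p _ ne rewrite eqℕ-no {suc p} {suc q} (λ e → ne (NP.suc-injective e)) | eqℕ-no {suc q} {0} (λ ())
    | ∧-zeroʳ (eqℕ (suc p) n) = ZP.*-zeroʳ (X p)
  diag : shiftEntry ε n q (suc q) ≡ 1ℤ
  diag rewrite eqℕ-yes {suc q} {suc q} refl = refl

times-shift : ∀ ε (M : ∀ n → Mat n) → IsShift ε M → ∀ {n} (x : Seq n) X → x ≈ₛ X →
  (x ·ᴹ M n) ≈ₛ rotate ε n X
times-shift ε M isM {n} x X r j =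
  trans (sumFin≡∑ n (λ i → cong₂ _*ᶻ_ (r i) (isM n i j))) (row-times-shift ε n X (toℕ j) (toℕ<n j))

-- x·M^k at j is the entry j-k of x, taken with sign ε when it wraps around;
-- as a formula: ε·(twist ε n x)_{j+n-k}.
shifted : ℤ → ℕ → Seq∞ → ℕ → Seq∞
shifted ε n X k j = ε *ᶻ twist ε n X (j + (n ∸ k))

-- By induction on k, using ε² = 1 when a wrapped entry wraps again.
power-shift : ∀ ε → ε *ᶻ ε ≡ 1ℤ → (M : ∀ n → Mat n) → IsShift ε M → ∀ {n} (x : Seq n) X → x ≈ₛ X →
  ∀ k → k ≤ n → powMul x (M n) k ≈ₛ shifted ε n X k
power-shift ε εε M isM {n} x X r zero _ = ≈ₛ-trans r unshifted
  where
  square : ∀ e y → e *ᶻ (e *ᶻ y) ≡ (e *ᶻ e) *ᶻ y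
  square = solve-∀
  unshifted : ∀ t → t < n → X t ≡ shifted ε n X 0 t
  unshifted t _ = sym (begin
      ε *ᶻ twist ε n X (t + n)      ≡⟨ cong (ε *ᶻ_) (twist-above ε n X (NP.m≤n+m n t)) ⟩
      ε *ᶻ (ε *ᶻ X (t + n ∸ n))     ≡⟨ square ε _ ⟩
      (ε *ᶻ ε) *ᶻ X (t + n ∸ n)     ≡⟨ cong (_*ᶻ X (t + n ∸ n)) εε ⟩
      1ℤ *ᶻ X (t + n ∸ n)           ≡⟨ ZP.*-identityˡ _ ⟩
      X (t + n ∸ n)                 ≡⟨ cong X (NP.m+n∸n≡m t n) ⟩
      X t                           ∎)
    where open ≡-Reasoning
power-shift ε εε M isM {zero} x X r (suc k) ()
power-shift ε εε M isM {suc n'} x X r (suc k) k<n =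
  ≈ₛ-trans (times-shift ε M isM (powMul x (M n) k) (shifted ε n X k)
             (power-shift ε εε M isM x X r k (NP.<⇒≤ k<n)))
           step
  where
  n = suc n'
  n∸k : n ∸ k ≡ suc (n ∸ suc k)
  n∸k = NP.+-∸-assoc 1 k<n
  cube : ∀ e y → e *ᶻ (e *ᶻ y) *ᶻ e ≡ (e *ᶻ e) *ᶻ (e *ᶻ y)
  cube = solve-∀
  wraps : n ≤ n' + (n ∸ k)
  wraps = subst (λ z → n ≤ n' + z) (sym n∸k) (subst (n ≤_) (sym (NP.+-suc n' _)) (s≤s (NP.m≤m+n n' _)))
  wrapped : n' + (n ∸ k) ∸ n ≡ n' ∸ k
  wrapped = trans (cong (λ z → n' + z ∸ n) n∸k) (trans (cong (_∸ n) (NP.+-suc n' _)) (NP.m+n∸m≡n n' _))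
  step : ∀ t → t < n → rotate ε n (shifted ε n X k) t ≡ shifted ε n X (suc k) t
  step (suc j) _ = trans (ZP.*-identityʳ _)
    (cong (λ z → ε *ᶻ twist ε n X z) (trans (cong (j +_) n∸k) (NP.+-suc j (n ∸ suc k))))
  step zero _ = begin
      ε *ᶻ twist ε n X (n' + (n ∸ k)) *ᶻ ε       ≡⟨ cong (λ z → ε *ᶻ z *ᶻ ε) (twist-above ε n X wraps) ⟩
      ε *ᶻ (ε *ᶻ X (n' + (n ∸ k) ∸ n)) *ᶻ ε      ≡⟨ cube ε _ ⟩
      (ε *ᶻ ε) *ᶻ (ε *ᶻ X (n' + (n ∸ k) ∸ n))    ≡⟨ cong (_*ᶻ (ε *ᶻ X (n' + (n ∸ k) ∸ n))) εε ⟩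
      1ℤ *ᶻ (ε *ᶻ X (n' + (n ∸ k) ∸ n))          ≡⟨ ZP.*-identityˡ _ ⟩
      ε *ᶻ X (n' + (n ∸ k) ∸ n)                  ≡⟨ cong (λ z → ε *ᶻ X z) wrapped ⟩
      ε *ᶻ X (n' ∸ k)                            ≡⟨ cong (ε *ᶻ_) (sym (twist-below ε n X (s≤s (NP.m∸n≤m n' k)))) ⟩
      ε *ᶻ twist ε n X (n' ∸ k)                  ∎
    where open ≡-Reasoning

autocorr≡corr : ∀ ε → ε *ᶻ ε ≡ 1ℤ → (M : ∀ n → Mat n) → IsShift ε M → ∀ {n} (x : Seq n) k → k ≤ n →
  dot x (powMul x (M n) k) ≡ ε *ᶻ corr ε n (ext x) (ext x) (n ∸ k)
autocorr≡corr ε εε M isM {n} x k k≤n =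
  trans (sumFin≡∑ n (λ i → cong₂ _*ᶻ_ (sym (ext-toℕ x i))
                              (power-shift ε εε M isM x (ext x) (λ i → sym (ext-toℕ x i)) k k≤n i)))
        (trans (∑-cong n (λ j _ → swap (ext x j) ε _)) (∑-*ˡ n ε _))
  where
  swap : ∀ a e b → a *ᶻ (e *ᶻ b) ≡ e *ᶻ (a *ᶻ b)
  swap = solve-∀

ComplementaryCorr : ℤ → ℕ → Seq∞ → Seq∞ → Set
ComplementaryCorr ε n x y = ∀ q → 0 < q → q < n → corr ε n x x q +ᶻ corr ε n y y q ≡ 0ℤ

ComplementaryMat : ∀ {n} → Mat n → Seq n → Seq n → Set
ComplementaryMat {n} M c d = ∀ k → 0 < k → k < n → dot c (powMul c M k) +ᶻ dot d (powMul d M k) ≡ 0ℤ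

-- The two notions agree for shift matrices, since lag k corresponds to lag n-k.
module _ (ε : ℤ) (εε : ε *ᶻ ε ≡ 1ℤ) (M : ∀ n → Mat n) (isM : IsShift ε M) where

  autocorr-sum : ∀ {n} (c d : Seq n) k → k ≤ n →
    dot c (powMul c (M n) k) +ᶻ dot d (powMul d (M n) k)
      ≡ ε *ᶻ (corr ε n (ext c) (ext c) (n ∸ k) +ᶻ corr ε n (ext d) (ext d) (n ∸ k))
  autocorr-sum c d k k≤n =
    trans (cong₂ _+ᶻ_ (autocorr≡corr ε εε M isM c k k≤n) (autocorr≡corr ε εε M isM d k k≤n))
          (sym (ZP.*-distribˡ-+ ε _ _))

  complementary⇒corr : ∀ {n} (c d : Seq n) → ComplementaryMat (M n) c d → ComplementaryCorr ε n (ext c) (ext d)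
  complementary⇒corr {n} c d hyp q 0<q q<n = begin
      cc +ᶻ dd                  ≡⟨ sym (ZP.*-identityˡ _) ⟩
      1ℤ *ᶻ (cc +ᶻ dd)          ≡⟨ cong (_*ᶻ (cc +ᶻ dd)) (sym εε) ⟩
      (ε *ᶻ ε) *ᶻ (cc +ᶻ dd)    ≡⟨ ZP.*-assoc ε ε _ ⟩
      ε *ᶻ (ε *ᶻ (cc +ᶻ dd))    ≡⟨ cong (λ z → ε *ᶻ (ε *ᶻ (corr ε n (ext c) (ext c) z +ᶻ corr ε n (ext d) (ext d) z)))
                                         (sym (NP.m∸[m∸n]≡n (NP.<⇒≤ q<n))) ⟩
      ε *ᶻ (ε *ᶻ (corr ε n (ext c) (ext c) (n ∸ k) +ᶻ corr ε n (ext d) (ext d) (n ∸ k)))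
                                ≡⟨ cong (ε *ᶻ_) (sym (autocorr-sum c d k (NP.m∸n≤m n q))) ⟩
      ε *ᶻ (dot c (powMul c (M n) k) +ᶻ dot d (powMul d (M n) k))
                                ≡⟨ cong (ε *ᶻ_) (hyp k (NP.m<n⇒0<n∸m q<n) (NP.∸-monoʳ-< 0<q (NP.<⇒≤ q<n))) ⟩
      ε *ᶻ 0ℤ                   ≡⟨ ZP.*-zeroʳ ε ⟩
      0ℤ                        ∎
    where
    open ≡-Reasoning
    k = n ∸ q
    cc = corr ε n (ext c) (ext c) q
    dd = corr ε n (ext d) (ext d) q

  corr⇒complementary : ∀ {n} (c d : Seq n) → ComplementaryCorr ε n (ext c) (ext d) → ComplementaryMat (M n) c d
  corr⇒complementary {n} c d hyp k 0<k k<n =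
    trans (autocorr-sum c d k (NP.<⇒≤ k<n))
          (trans (cong (ε *ᶻ_) (hyp (n ∸ k) (NP.m<n⇒0<n∸m k<n) (NP.∸-monoʳ-< 0<k (NP.<⇒≤ k<n))))
                 (ZP.*-zeroʳ ε))

rev : ℕ → Seq∞ → Seq∞
rev v y j = y (v ∸ suc j)

∸-suc : ∀ {l m} → l < m → m ∸ l ≡ suc (m ∸ suc l)
∸-suc l<m = NP.+-∸-assoc 1 l<m

reflect-involutive : ∀ {l m} → l < m → m ∸ suc (m ∸ suc l) ≡ l
reflect-involutive {l} {m} l<m = trans (cong (m ∸_) (sym (∸-suc l<m))) (NP.m∸[m∸n]≡n (NP.<⇒≤ l<m))

reflect-< : ∀ {j v} → j < v → v ∸ suc j < v
reflect-< j<v = NP.∸-monoʳ-< (s≤s z≤n) j<v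

rev-involutive : ∀ v (x : Seq∞) t → t < v → rev v (rev v x) t ≡ x t
rev-involutive v x t t<v = cong x (reflect-involutive t<v)

∑-convolution-comm : ∀ m (f h : Seq∞) → ∑ m (λ j → f j *ᶻ h (m ∸ suc j)) ≡ ∑ m (λ j → h j *ᶻ f (m ∸ suc j))
∑-convolution-comm m f h = trans (∑-reverse m _) (∑-cong m (λ l l<m →
  trans (cong (λ z → f (m ∸ suc l) *ᶻ h z) (reflect-involutive l<m)) (ZP.*-comm (f (m ∸ suc l)) (h l))))

corr-rev-split : ∀ ε m Q x y → corr ε (m + Q) x (rev (m + Q) y) Q
  ≡ ∑ m (λ j → x j *ᶻ y (m ∸ suc j)) +ᶻ ∑ Q (λ j → x (m + j) *ᶻ (ε *ᶻ y (m + Q ∸ suc j)))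
corr-rev-split ε m Q x y = trans (∑-split m Q _) (cong₂ _+ᶻ_ (∑-cong m unwrapped) (∑-cong Q wrapped))
  where
  unwrapped : ∀ j → j < m → x j *ᶻ twist ε (m + Q) (rev (m + Q) y) (j + Q) ≡ x j *ᶻ y (m ∸ suc j)
  unwrapped j j<m = cong (x j *ᶻ_) (trans (twist-below ε (m + Q) _ (NP.+-monoˡ-< Q j<m))
    (cong y (trans (cong₂ _∸_ (NP.+-comm m Q) (NP.+-comm (suc j) Q)) (NP.[m+n]∸[m+o]≡n∸o Q m (suc j)))))
  wrapped : ∀ j → j < Q → x (m + j) *ᶻ twist ε (m + Q) (rev (m + Q) y) (m + j + Q)
                          ≡ x (m + j) *ᶻ (ε *ᶻ y (m + Q ∸ suc j))
  wrapped j j<Q = cong (x (m + j) *ᶻ_)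
      (trans (twist-above ε (m + Q) _ (subst (m + Q ≤_) (sym reorder) (NP.m≤m+n (m + Q) j)))
             (cong (λ z → ε *ᶻ y (m + Q ∸ suc z)) (trans (cong (_∸ (m + Q)) reorder) (NP.m+n∸m≡n (m + Q) j))))
    where
    reorder : m + j + Q ≡ m + Q + j
    reorder = trans (NP.+-assoc m j Q) (trans (cong (m +_) (NP.+-comm j Q)) (sym (NP.+-assoc m Q j)))

corr-rev-swap : ∀ ε v q x y → q ≤ v → corr ε v x (rev v y) q ≡ corr ε v y (rev v x) q
corr-rev-swap ε v q x y q≤v with v ∸ q | NP.m∸n+n≡m q≤v
... | m | refl = begin
    corr ε (m + q) x (rev (m + q) y) q  ≡⟨ corr-rev-split ε m q x y ⟩
    ∑ m (λ j → x j *ᶻ y (m ∸ suc j)) +ᶻ ∑ q (λ j → x (m + j) *ᶻ (ε *ᶻ y (m + q ∸ suc j)))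
      ≡⟨ cong₂ _+ᶻ_ (∑-convolution-comm m x y) wrapped-symm ⟩
    ∑ m (λ j → y j *ᶻ x (m ∸ suc j)) +ᶻ ∑ q (λ j → y (m + j) *ᶻ (ε *ᶻ x (m + q ∸ suc j)))
      ≡⟨ sym (corr-rev-split ε m q y x) ⟩
    corr ε (m + q) y (rev (m + q) x) q  ∎
  where
  open ≡-Reasoning
  shuffle : ∀ a b e → a *ᶻ (e *ᶻ b) ≡ b *ᶻ (e *ᶻ a)
  shuffle = solve-∀
  outer : ∀ l → l < q → m + (q ∸ suc l) ≡ m + q ∸ suc l
  outer l l<q = sym (NP.+-∸-assoc m l<q)
  inner : ∀ l → l < q → m + q ∸ suc (q ∸ suc l) ≡ m + l
  inner l l<q = trans (NP.+-∸-assoc m (subst (_≤ q) (∸-suc l<q) (NP.m∸n≤m q l))) (cong (m +_) (reflect-involutive l<q))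
  wrapped-symm : ∑ q (λ j → x (m + j) *ᶻ (ε *ᶻ y (m + q ∸ suc j))) ≡ ∑ q (λ j → y (m + j) *ᶻ (ε *ᶻ x (m + q ∸ suc j)))
  wrapped-symm = trans (∑-reverse q _) (∑-cong q (λ l l<q →
    trans (cong₂ (λ p p' → x p *ᶻ (ε *ᶻ y p')) (outer l l<q) (inner l l<q)) (shuffle (x (m + q ∸ suc l)) (y (m + l)) ε)))

corr-rev-rev : ∀ ε v q x → q ≤ v → corr ε v (rev v x) (rev v x) q ≡ corr ε v x x q
corr-rev-rev ε v q x q≤v =
  trans (corr-rev-swap ε v q (rev v x) x q≤v) (corr-cong ε v {x = x} q q≤v (λ _ _ → refl) (rev-involutive v x))

corr-revˡ : ∀ ε v q x y → q ≤ v → corr ε v (rev v x) y q ≡ corr ε v (rev v y) x q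
corr-revˡ ε v q x y q≤v =
  trans (corr-cong ε v {x = rev v x} q q≤v (λ _ _ → refl) (λ t p → sym (rev-involutive v y t p)))
        (trans (corr-rev-swap ε v q (rev v x) (rev v y) q≤v)
               (corr-cong ε v {x = rev v y} q q≤v (λ _ _ → refl) (rev-involutive v x)))

kron : ∀ g .{{_ : NonZero g}} → Seq∞ → Seq∞ → Seq∞
kron g X Y t = X (t % g) *ᶻ Y (t / g)

kron-block : ∀ g .{{_ : NonZero g}} X Y j i → i < g → kron g X Y (g * j + i) ≡ X i *ᶻ Y j
kron-block g X Y j i p = cong₂ _*ᶻ_ (cong X (block-rem g j i p)) (cong Y (block-quot g j i p))

trunc : ℕ → Seq∞ → Seq∞
trunc g y m with m <? g
... | yes _ = y m
... | no _  = 0ℤ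

delay : ℕ → Seq∞ → Seq∞
delay g y m with m <? g
... | yes _ = 0ℤ
... | no _  = y (m ∸ g)

-- Aperiodic correlation of the first g entries of x and y at lag r, and its
-- overflow: the terms whose index i + r runs past g into the next block.
aper overflow : ℕ → Seq∞ → Seq∞ → ℕ → ℤ
aper     g x y r = ∑ g (λ i → x i *ᶻ trunc g y (i + r))
overflow g x y r = ∑ g (λ i → x i *ᶻ delay g y (i + r))

twist-kron : ∀ ε g .{{_ : NonZero g}} v X Y J i → i < g →
  twist ε (g * v) (kron g X Y) (g * J + i) ≡ X i *ᶻ twist ε v Y J
twist-kron ε g v X Y J i i<g with J <? v
... | yes J<v = trans (twist-below ε (g * v) _ (block-bound g i<g J<v)) (kron-block g X Y J i i<g)
... | no J≮v  = begin
    twist ε (g * v) (kron g X Y) (g * J + i)   ≡⟨ twist-above ε (g * v) _ wraps ⟩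
    ε *ᶻ kron g X Y (g * J + i ∸ g * v)         ≡⟨ cong (λ z → ε *ᶻ kron g X Y z) wrapped ⟩
    ε *ᶻ kron g X Y (g * (J ∸ v) + i)           ≡⟨ cong (ε *ᶻ_) (kron-block g X Y (J ∸ v) i i<g) ⟩
    ε *ᶻ (X i *ᶻ Y (J ∸ v))                     ≡⟨ shuffle ε (X i) (Y (J ∸ v)) ⟩
    X i *ᶻ (ε *ᶻ Y (J ∸ v))                     ∎
  where
  open ≡-Reasoning
  v≤J = NP.≮⇒≥ J≮v
  shuffle : ∀ e x y → e *ᶻ (x *ᶻ y) ≡ x *ᶻ (e *ᶻ y)
  shuffle = solve-∀
  split : g * J + i ≡ (g * (J ∸ v) + i) + g * v
  split = begin
      g * J + i                     ≡⟨ cong (λ z → g * z + i) (sym (NP.m∸n+n≡m v≤J)) ⟩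
      g * (J ∸ v + v) + i           ≡⟨ cong (_+ i) (NP.*-distribˡ-+ g (J ∸ v) v) ⟩
      g * (J ∸ v) + g * v + i       ≡⟨ NP.+-assoc (g * (J ∸ v)) _ i ⟩
      g * (J ∸ v) + (g * v + i)     ≡⟨ cong (g * (J ∸ v) +_) (NP.+-comm (g * v) i) ⟩
      g * (J ∸ v) + (i + g * v)     ≡⟨ sym (NP.+-assoc (g * (J ∸ v)) i _) ⟩
      g * (J ∸ v) + i + g * v       ∎
  wraps : g * v ≤ g * J + i
  wraps = subst (g * v ≤_) (sym split) (NP.m≤n+m (g * v) _)
  wrapped : g * J + i ∸ g * v ≡ g * (J ∸ v) + i
  wrapped = trans (cong (_∸ g * v) split) (NP.m+n∸n≡m _ (g * v))

twist-kron-carry : ∀ ε g .{{_ : NonZero g}} v X Y J p → p < g + g →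
  twist ε (g * v) (kron g X Y) (g * J + p) ≡ trunc g X p *ᶻ twist ε v Y J +ᶻ delay g X p *ᶻ twist ε v Y (suc J)
twist-kron-carry ε g v X Y J p p<2g with p <? g
... | yes p<g = trans (twist-kron ε g v X Y J p p<g)
    (sym (trans (cong (X p *ᶻ twist ε v Y J +ᶻ_) (ZP.*-zeroˡ (twist ε v Y (suc J)))) (ZP.+-identityʳ _)))
... | no p≮g = trans (cong (twist ε (g * v) (kron g X Y)) carry)
    (trans (twist-kron ε g v X Y (suc J) (p ∸ g) (∸-below p<2g g≤p))
      (sym (trans (cong (_+ᶻ X (p ∸ g) *ᶻ twist ε v Y (suc J)) (ZP.*-zeroˡ (twist ε v Y J))) (ZP.+-identityˡ _))))
  where
  g≤p = NP.≮⇒≥ p≮g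
  carry : g * J + p ≡ g * suc J + (p ∸ g)
  carry = begin
      g * J + p               ≡⟨ cong (g * J +_) (sym (NP.m+[n∸m]≡n g≤p)) ⟩
      g * J + (g + (p ∸ g))   ≡⟨ sym (NP.+-assoc (g * J) g _) ⟩
      g * J + g + (p ∸ g)     ≡⟨ cong (_+ (p ∸ g)) (trans (NP.+-comm (g * J) g) (sym (NP.*-suc g J))) ⟩
      g * suc J + (p ∸ g)     ∎
    where open ≡-Reasoning

corr-kron : ∀ ε g .{{_ : NonZero g}} v X Y X' Y' Q r → r < g →
  corr ε (g * v) (kron g X Y) (kron g X' Y') (g * Q + r)
    ≡ aper g X X' r *ᶻ corr ε v Y Y' Q +ᶻ overflow g X X' r *ᶻ corr ε v Y Y' (suc Q)
corr-kron ε g v X Y X' Y' Q r r<g = begin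
    corr ε (g * v) (kron g X Y) (kron g X' Y') (g * Q + r)
      ≡⟨ ∑-blocks g v _ ⟩
    ∑ v (λ j → ∑ g (λ i → kron g X Y (g * j + i) *ᶻ twist ε (g * v) (kron g X' Y') (g * j + i + (g * Q + r))))
      ≡⟨ ∑-cong v (λ j _ → ∑-cong g (λ i i<g → term j i i<g)) ⟩
    ∑ v (λ j → ∑ g (λ i → (X i *ᶻ trunc g X' (i + r)) *ᶻ (Y j *ᶻ twist ε v Y' (j + Q))
                        +ᶻ (X i *ᶻ delay g X' (i + r)) *ᶻ (Y j *ᶻ twist ε v Y' (j + suc Q))))
      ≡⟨ ∑∑-bilinear g v _ _ _ _ ⟩
    aper g X X' r *ᶻ corr ε v Y Y' Q +ᶻ overflow g X X' r *ᶻ corr ε v Y Y' (suc Q) ∎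
  where
  open ≡-Reasoning
  regroup : ∀ x y l p h p' → (x *ᶻ y) *ᶻ (l *ᶻ p +ᶻ h *ᶻ p') ≡ (x *ᶻ l) *ᶻ (y *ᶻ p) +ᶻ (x *ᶻ h) *ᶻ (y *ᶻ p')
  regroup = solve-∀
  lag : ∀ j i → g * j + i + (g * Q + r) ≡ g * (j + Q) + (i + r)
  lag j i = begin
      g * j + i + (g * Q + r)     ≡⟨ NP.+-assoc (g * j) i _ ⟩
      g * j + (i + (g * Q + r))   ≡⟨ cong (g * j +_) (trans (sym (NP.+-assoc i (g * Q) r))
                                       (trans (cong (_+ r) (NP.+-comm i (g * Q))) (NP.+-assoc (g * Q) i r))) ⟩
      g * j + (g * Q + (i + r))   ≡⟨ sym (NP.+-assoc (g * j) (g * Q) _) ⟩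
      g * j + g * Q + (i + r)     ≡⟨ cong (_+ (i + r)) (sym (NP.*-distribˡ-+ g j Q)) ⟩
      g * (j + Q) + (i + r)       ∎
  term : ∀ j i → i < g →
    kron g X Y (g * j + i) *ᶻ twist ε (g * v) (kron g X' Y') (g * j + i + (g * Q + r))
      ≡ (X i *ᶻ trunc g X' (i + r)) *ᶻ (Y j *ᶻ twist ε v Y' (j + Q))
        +ᶻ (X i *ᶻ delay g X' (i + r)) *ᶻ (Y j *ᶻ twist ε v Y' (j + suc Q))
  term j i i<g = begin
      kron g X Y (g * j + i) *ᶻ twist ε (g * v) (kron g X' Y') (g * j + i + (g * Q + r))
        ≡⟨ cong₂ _*ᶻ_ (kron-block g X Y j i i<g)
             (trans (cong (twist ε (g * v) (kron g X' Y')) (lag j i))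
                    (twist-kron-carry ε g v X' Y' (j + Q) (i + r) (NP.+-mono-< i<g r<g))) ⟩
      (X i *ᶻ Y j) *ᶻ (trunc g X' (i + r) *ᶻ twist ε v Y' (j + Q) +ᶻ delay g X' (i + r) *ᶻ twist ε v Y' (suc (j + Q)))
        ≡⟨ cong (λ z → (X i *ᶻ Y j) *ᶻ (trunc g X' (i + r) *ᶻ twist ε v Y' (j + Q) +ᶻ delay g X' (i + r) *ᶻ twist ε v Y' z))
                (sym (NP.+-suc j Q)) ⟩
      (X i *ᶻ Y j) *ᶻ (trunc g X' (i + r) *ᶻ twist ε v Y' (j + Q) +ᶻ delay g X' (i + r) *ᶻ twist ε v Y' (j + suc Q))
        ≡⟨ regroup (X i) (Y j) (trunc g X' (i + r)) (twist ε v Y' (j + Q)) (delay g X' (i + r)) (twist ε v Y' (j + suc Q)) ⟩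
      (X i *ᶻ trunc g X' (i + r)) *ᶻ (Y j *ᶻ twist ε v Y' (j + Q))
        +ᶻ (X i *ᶻ delay g X' (i + r)) *ᶻ (Y j *ᶻ twist ε v Y' (j + suc Q)) ∎

trunc-below : ∀ n y {m} → m < n → trunc n y m ≡ y m
trunc-below n y {m} p with m <? n
... | yes _ = refl
... | no q  = ⊥-elim (q p)

trunc-above : ∀ n y {m} → n ≤ m → trunc n y m ≡ 0ℤ
trunc-above n y {m} p with m <? n
... | yes q = ⊥-elim (NP.<⇒≱ q p)
... | no _  = refl

delay-below : ∀ n y {m} → m < n → delay n y m ≡ 0ℤ
delay-below n y {m} p with m <? n
... | yes _ = refl
... | no q  = ⊥-elim (q p)

delay-above : ∀ n y {m} → n ≤ m → delay n y m ≡ y (m ∸ n)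
delay-above n y {m} p with m <? n
... | yes q = ⊥-elim (NP.<⇒≱ q p)
... | no _  = refl

overflow≡aper : ∀ g r (x : Seq∞) → r ≤ g → overflow g x x r ≡ aper g x x (g ∸ r)
overflow≡aper g r x r≤g with g ∸ r | NP.m∸n+n≡m r≤g
... | m | refl = begin
    overflow (m + r) x x r
      ≡⟨ ∑-split m r _ ⟩
    ∑ m (λ i → x i *ᶻ delay (m + r) x (i + r)) +ᶻ ∑ r (λ i → x (m + i) *ᶻ delay (m + r) x (m + i + r))
      ≡⟨ cong₂ _+ᶻ_ (∑-zero m (λ i i<m → trans (cong (x i *ᶻ_) (delay-below (m + r) x (NP.+-monoˡ-< r i<m)))
                                               (ZP.*-zeroʳ (x i))))
                    (∑-cong r (λ i _ → cong (x (m + i) *ᶻ_) (trans (delay-above (m + r) x (past i)) (cong x (back i))))) ⟩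
    0ℤ +ᶻ ∑ r (λ i → x (m + i) *ᶻ x i)
      ≡⟨ ZP.+-identityˡ _ ⟩
    ∑ r (λ i → x (m + i) *ᶻ x i)
      ≡⟨ ∑-cong r (λ i _ → trans (ZP.*-comm (x (m + i)) (x i)) (cong (λ z → x i *ᶻ x z) (NP.+-comm m i))) ⟩
    ∑ r (λ i → x i *ᶻ x (i + m))
      ≡⟨ sym (ZP.+-identityʳ _) ⟩
    ∑ r (λ i → x i *ᶻ x (i + m)) +ᶻ 0ℤ
      ≡⟨ sym (cong₂ _+ᶻ_ (∑-cong r (λ i i<r → cong (x i *ᶻ_) (trunc-below (m + r) x (inside i i<r))))
                         (∑-zero m (λ i _ → trans (cong (x (r + i) *ᶻ_) (trunc-above (m + r) x (outside i)))
                                                  (ZP.*-zeroʳ (x (r + i)))))) ⟩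
    ∑ r (λ i → x i *ᶻ trunc (m + r) x (i + m)) +ᶻ ∑ m (λ i → x (r + i) *ᶻ trunc (m + r) x (r + i + m))
      ≡⟨ sym (∑-split r m _) ⟩
    ∑ (r + m) (λ i → x i *ᶻ trunc (m + r) x (i + m))
      ≡⟨ ∑-length _ (NP.+-comm r m) ⟩
    aper (m + r) x x m ∎
  where
  open ≡-Reasoning
  past : ∀ i → m + r ≤ m + i + r
  past i = NP.+-monoˡ-≤ r (NP.m≤m+n m i)
  back : ∀ i → m + i + r ∸ (m + r) ≡ i
  back i = trans (trans (cong₂ _∸_ (NP.+-comm (m + i) r) (NP.+-comm m r)) (NP.[m+n]∸[m+o]≡n∸o r (m + i) m))
                 (NP.m+n∸m≡n m i)
  inside : ∀ i → i < r → i + m < m + r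
  inside i i<r = subst (i + m <_) (NP.+-comm r m) (NP.+-monoˡ-< m i<r)
  outside : ∀ i → m + r ≤ r + i + m
  outside i = subst (_≤ r + i + m) (NP.+-comm r m) (NP.+-monoˡ-≤ m (NP.m≤m+n r i))

trunc-ext : ∀ {n} (a : Seq n) m → trunc n (ext a) m ≡ ext a m
trunc-ext {n} a m with m <? n
... | yes q = ext-fromℕ< a q
... | no _  = refl

AF≡aper : ∀ {g} (a : Seq g) r → AF a r ≡ aper g (ext a) (ext a) r
AF≡aper {g} a r = sumFin≡∑ g (λ i → cong₂ _*ᶻ_ (sym (ext-toℕ a i)) (sym (trunc-ext a (toℕ i + r))))

-- Pointwise negation.  f contains -t, so we need that aper and overflow change
-- sign when either argument is negated.
neg : Seq∞ → Seq∞
neg y m = - y m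

trunc-neg : ∀ g y p → trunc g (neg y) p ≡ - trunc g y p
trunc-neg g y p with p <? g
... | yes _ = refl
... | no _  = refl

delay-neg : ∀ g y p → delay g (neg y) p ≡ - delay g y p
delay-neg g y p with p <? g
... | yes _ = refl
... | no _  = refl

aper-negˡ : ∀ g x y r → aper g (neg x) y r ≡ - aper g x y r
aper-negˡ g x y r = trans (∑-cong g (λ i _ → sym (ZP.neg-distribˡ-* (x i) _))) (∑-neg g _)

aper-negʳ : ∀ g x y r → aper g x (neg y) r ≡ - aper g x y r
aper-negʳ g x y r = trans (∑-cong g (λ i _ → trans (cong (x i *ᶻ_) (trunc-neg g y (i + r)))
                                                   (sym (ZP.neg-distribʳ-* (x i) _)))) (∑-neg g _)

overflow-negˡ : ∀ g x y r → overflow g (neg x) y r ≡ - overflow g x y r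
overflow-negˡ g x y r = trans (∑-cong g (λ i _ → sym (ZP.neg-distribˡ-* (x i) _))) (∑-neg g _)

overflow-negʳ : ∀ g x y r → overflow g x (neg y) r ≡ - overflow g x y r
overflow-negʳ g x y r = trans (∑-cong g (λ i _ → trans (cong (x i *ᶻ_) (delay-neg g y (i + r)))
                                                       (sym (ZP.neg-distribʳ-* (x i) _)))) (∑-neg g _)

data HalfPair : ℤ → ℤ → ℤ → ℤ → Set where
  agree⁺  : HalfPair 1ℤ 1ℤ 1ℤ 0ℤ
  agree⁻  : HalfPair -1ℤ -1ℤ -1ℤ 0ℤ
  differ⁺ : HalfPair 1ℤ -1ℤ 0ℤ 1ℤ
  differ⁻ : HalfPair -1ℤ 1ℤ 0ℤ -1ℤ

halfPair : ∀ {g} (a b : Seq g) → Binary a → Binary b → ∀ i →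
  HalfPair (a i) (b i) (half (a i +ᶻ b i)) (half (a i -ᶻ b i))
halfPair a b ha hb i with ha i | hb i
... | inj₁ e | inj₁ e' rewrite e | e' = agree⁺
... | inj₂ e | inj₂ e' rewrite e | e' = agree⁻
... | inj₁ e | inj₂ e' rewrite e | e' = differ⁺
... | inj₂ e | inj₁ e' rewrite e | e' = differ⁻

half-antisym : ∀ {a b s t} → HalfPair a b s t → half (b -ᶻ a) ≡ - t
half-antisym agree⁺  = refl
half-antisym agree⁻  = refl
half-antisym differ⁺ = refl
half-antisym differ⁻ = refl

halves-product : ∀ {a b s t a' b' s' t'} → HalfPair a b s t → HalfPair a' b' s' t' →
  Z.+ 2 *ᶻ (s *ᶻ s' +ᶻ t *ᶻ t') ≡ a *ᶻ a' +ᶻ b *ᶻ b'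
halves-product agree⁺  agree⁺  = refl
halves-product agree⁺  agree⁻  = refl
halves-product agree⁺  differ⁺ = refl
halves-product agree⁺  differ⁻ = refl
halves-product agree⁻  agree⁺  = refl
halves-product agree⁻  agree⁻  = refl
halves-product agree⁻  differ⁺ = refl
halves-product agree⁻  differ⁻ = refl
halves-product differ⁺ agree⁺  = refl
halves-product differ⁺ agree⁻  = refl
halves-product differ⁺ differ⁺ = refl
halves-product differ⁺ differ⁻ = refl
halves-product differ⁻ agree⁺  = refl
halves-product differ⁻ agree⁻  = refl
halves-product differ⁻ differ⁺ = refl
halves-product differ⁻ differ⁻ = refl

ext-above : ∀ {n} (a : Seq n) {m} → n ≤ m → ext a m ≡ 0ℤ
ext-above {n} a {m} p with m <? n
... | yes q = ⊥-elim (NP.<⇒≱ q p)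
... | no _  = refl

module GolayHalves {g : ℕ} (a b : Seq g) (ha : Binary a) (hb : Binary b) where
  aN bN sN tN : Seq∞
  aN = ext a
  bN = ext b
  sN = ext (hsum a b)
  tN = ext (hdiff a b)

  halves : ∀ m → m < g → HalfPair (aN m) (bN m) (sN m) (tN m)
  halves m p rewrite ext-fromℕ< a p | ext-fromℕ< b p | ext-fromℕ< (hsum a b) p | ext-fromℕ< (hdiff a b) p =
    halfPair a b ha hb (fromℕ< p)

  hdiff'≡neg : ∀ m → ext (hdiff' a b) m ≡ neg tN m
  hdiff'≡neg m with g ℕ.≤? m
  ... | yes g≤m = trans (ext-above (hdiff' a b) g≤m) (cong -_ (sym (ext-above (hdiff a b) g≤m)))
  ... | no g≰m  = trans (ext-fromℕ< (hdiff' a b) m<g)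
                    (trans (half-antisym (halfPair a b ha hb (fromℕ< m<g))) (cong -_ (sym (ext-fromℕ< (hdiff a b) m<g))))
    where m<g = NP.≰⇒> g≰m

  halves-term : ∀ m m' → m < g →
    Z.+ 2 *ᶻ (sN m *ᶻ sN m' +ᶻ tN m *ᶻ tN m') ≡ aN m *ᶻ aN m' +ᶻ bN m *ᶻ bN m'
  halves-term m m' p with g ℕ.≤? m'
  ... | no g≰m' = halves-product (halves m p) (halves m' (NP.≰⇒> g≰m'))
  ... | yes q   rewrite ext-above a q | ext-above b q | ext-above (hsum a b) q | ext-above (hdiff a b) q =
    zeros (sN m) (tN m) (aN m) (bN m)
    where
    zeros : ∀ s t a b → Z.+ 2 *ᶻ (s *ᶻ 0ℤ +ᶻ t *ᶻ 0ℤ) ≡ a *ᶻ 0ℤ +ᶻ b *ᶻ 0ℤ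
    zeros = solve-∀

  aper-halves : ∀ r → Z.+ 2 *ᶻ (aper g sN sN r +ᶻ aper g tN tN r) ≡ aper g aN aN r +ᶻ aper g bN bN r
  aper-halves r = begin
      Z.+ 2 *ᶻ (aper g sN sN r +ᶻ aper g tN tN r)     ≡⟨ cong (Z.+ 2 *ᶻ_) (sym (∑-+ g _ _)) ⟩
      Z.+ 2 *ᶻ ∑ g (λ i → sN i *ᶻ trunc g sN (i + r) +ᶻ tN i *ᶻ trunc g tN (i + r))
                                                       ≡⟨ sym (∑-*ˡ g (Z.+ 2) _) ⟩
      ∑ g (λ i → Z.+ 2 *ᶻ (sN i *ᶻ trunc g sN (i + r) +ᶻ tN i *ᶻ trunc g tN (i + r)))
                                                       ≡⟨ ∑-cong g term ⟩
      ∑ g (λ i → aN i *ᶻ trunc g aN (i + r) +ᶻ bN i *ᶻ trunc g bN (i + r))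
                                                       ≡⟨ ∑-+ g _ _ ⟩
      aper g aN aN r +ᶻ aper g bN bN r                 ∎
    where
    open ≡-Reasoning
    term : ∀ i → i < g → Z.+ 2 *ᶻ (sN i *ᶻ trunc g sN (i + r) +ᶻ tN i *ᶻ trunc g tN (i + r))
                         ≡ aN i *ᶻ trunc g aN (i + r) +ᶻ bN i *ᶻ trunc g bN (i + r)
    term i i<g rewrite trunc-ext (hsum a b) (i + r) | trunc-ext (hdiff a b) (i + r)
                     | trunc-ext a (i + r) | trunc-ext b (i + r) = halves-term i (i + r) i<g

  module _ (golay : ∀ k → 1 ≤ k → AF a k +ᶻ AF b k ≡ 0ℤ) where

    halve : ∀ x → Z.+ 2 *ᶻ x ≡ 0ℤ → x ≡ 0ℤ
    halve x = ZP.*-cancelˡ-≡ (Z.+ 2) x 0ℤ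

    aper-halves-vanish : ∀ r → 1 ≤ r → aper g sN sN r +ᶻ aper g tN tN r ≡ 0ℤ
    aper-halves-vanish r 1≤r = halve _ (begin
      Z.+ 2 *ᶻ (aper g sN sN r +ᶻ aper g tN tN r) ≡⟨ aper-halves r ⟩
      aper g aN aN r +ᶻ aper g bN bN r              ≡⟨ sym (cong₂ _+ᶻ_ (AF≡aper a r) (AF≡aper b r)) ⟩
      AF a r +ᶻ AF b r                              ≡⟨ golay r 1≤r ⟩
      0ℤ                                            ∎)
      where open ≡-Reasoning

    overflow-halves-vanish : ∀ r → r < g → overflow g sN sN r +ᶻ overflow g tN tN r ≡ 0ℤ
    overflow-halves-vanish r r<g =
      trans (cong₂ _+ᶻ_ (overflow≡aper g r sN (NP.<⇒≤ r<g)) (overflow≡aper g r tN (NP.<⇒≤ r<g)))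
            (aper-halves-vanish (g ∸ r) (NP.m<n⇒0<n∸m r<g))

∑∑-select : ∀ g .{{_ : NonZero g}} v (φ : ℕ → ℕ) (H C : Seq∞) T i₀ q₀ → i₀ < g → q₀ < v →
  T ≡ g * φ q₀ + i₀ → (∀ q → q < v → φ q ≡ φ q₀ → q ≡ q₀) →
  ∑ g (λ p → ∑ v (λ q → if eqℕ (p + g * φ q) T then H p *ᶻ C q else 0ℤ)) ≡ H i₀ *ᶻ C q₀
∑∑-select g v φ H C T i₀ q₀ i₀<g q₀<v T≡ injective =
  trans (∑-single g i₀ i₀<g other-rows) (trans (∑-single v q₀ q₀<v other-columns) selected)
  where
  swap : ∀ p q → p + g * φ q ≡ g * φ q + p
  swap p q = NP.+-comm p (g * φ q)
  other-rows : ∀ p → p < g → p ≢ i₀ → ∑ v (λ q → if eqℕ (p + g * φ q) T then H p *ᶻ C q else 0ℤ) ≡ 0ℤ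
  other-rows p p<g p≢i₀ = ∑-zero v (λ q _ → vanish q)
    where
    vanish : ∀ q → (if eqℕ (p + g * φ q) T then H p *ᶻ C q else 0ℤ) ≡ 0ℤ
    vanish q rewrite eqℕ-no {p + g * φ q} {T}
      (λ e → p≢i₀ (proj₁ (block-unique g p<g i₀<g (trans (sym (swap p q)) (trans e T≡))))) = refl
  other-columns : ∀ q → q < v → q ≢ q₀ → (if eqℕ (i₀ + g * φ q) T then H i₀ *ᶻ C q else 0ℤ) ≡ 0ℤ
  other-columns q q<v q≢q₀ rewrite eqℕ-no {i₀ + g * φ q} {T}
    (λ e → q≢q₀ (injective q q<v (proj₂ (block-unique g i₀<g i₀<g (trans (sym (swap i₀ q)) (trans e T≡)))))) = refl
  selected : (if eqℕ (i₀ + g * φ q₀) T then H i₀ *ᶻ C q₀ else 0ℤ) ≡ H i₀ *ᶻ C q₀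
  selected rewrite eqℕ-yes {i₀ + g * φ q₀} {T} (trans (swap i₀ q₀) (sym T≡)) = refl

polyCoeff≡∑∑ : ∀ g v (φ : ℕ → ℕ) (h : Seq g) (c : Seq v) (T : ℕ) →
  sumFin (λ i → sumFin (λ j → if eqℕ (toℕ i + g * φ (toℕ j)) T then h i *ᶻ c j else 0ℤ))
    ≡ ∑ g (λ p → ∑ v (λ q → if eqℕ (p + g * φ q) T then ext h p *ᶻ ext c q else 0ℤ))
polyCoeff≡∑∑ g v φ h c T = sumFin≡∑ g (λ i → sumFin≡∑ v (λ j →
  cong (λ z → if eqℕ (toℕ i + g * φ (toℕ j)) T then z else 0ℤ) (cong₂ _*ᶻ_ (sym (ext-toℕ h i)) (sym (ext-toℕ c j)))))

polyZg≈kron : ∀ g .{{_ : NonZero g}} v (h : Seq g) (c : Seq v) → polyZg h c ≈ₛ kron g (ext h) (ext c)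
polyZg≈kron g v h c t =
  trans (polyCoeff≡∑∑ g v (λ q → q) h c T)
        (∑∑-select g v (λ q → q) (ext h) (ext c) T (T % g) (T / g) (proj₁ (proj₂ d)) (proj₂ (proj₂ d)) (proj₁ d)
                   (λ q _ e → e))
  where
  T = toℕ t
  d = block-decomp g v T (toℕ<n t)

reflect : ∀ v q → v ∸ 1 ∸ q ≡ v ∸ suc q
reflect v q = NP.∸-+-assoc v 1 q

polyZmg≈kron : ∀ g .{{_ : NonZero g}} v (h : Seq g) (c : Seq v) → polyZmg h c ≈ₛ kron g (ext h) (rev v (ext c))
polyZmg≈kron g v h c t =
  trans (polyCoeff≡∑∑ g v (λ q → v ∸ 1 ∸ q) h c T)
        (∑∑-select g v (λ q → v ∸ 1 ∸ q) (ext h) (ext c) T (T % g) q₀ (proj₁ (proj₂ d)) q₀<v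
                   (trans (proj₁ d) (cong (λ z → g * z + T % g) (sym reflect-q₀))) injective)
  where
  T = toℕ t
  d = block-decomp g v T (toℕ<n t)
  j<v = proj₂ (proj₂ d)
  q₀ = v ∸ suc (T / g)
  q₀<v : q₀ < v
  q₀<v = reflect-< j<v
  reflect-q₀ : v ∸ 1 ∸ q₀ ≡ T / g
  reflect-q₀ = trans (reflect v q₀) (reflect-involutive j<v)
  injective : ∀ q → q < v → v ∸ 1 ∸ q ≡ v ∸ 1 ∸ q₀ → q ≡ q₀
  injective q q<v e = trans (sym (reflect-involutive q<v))
                            (cong (v ∸_) (cong suc (trans (sym (reflect v q)) (trans e reflect-q₀))))

IsTernary : ℤ → Set
IsTernary z = z ≡ 0ℤ ⊎ z ≡ 1ℤ ⊎ z ≡ -1ℤ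

IsTernary-neg : ∀ {x} → IsTernary x → IsTernary (- x)
IsTernary-neg (inj₁ refl)        = inj₁ refl
IsTernary-neg (inj₂ (inj₁ refl)) = inj₂ (inj₂ refl)
IsTernary-neg (inj₂ (inj₂ refl)) = inj₂ (inj₁ refl)

ext-ternary : ∀ {n} (c : Seq n) → Ternary c → ∀ m → m < n → IsTernary (ext c m)
ext-ternary c hc m p rewrite ext-fromℕ< c p = hc (fromℕ< p)

HalfPair-swap : ∀ {a b s t} → HalfPair a b s t → HalfPair b a s (- t)
HalfPair-swap agree⁺  = agree⁺
HalfPair-swap agree⁻  = agree⁻
HalfPair-swap differ⁺ = differ⁻
HalfPair-swap differ⁻ = differ⁺

-- The value of s·x + t·y: one of ±x, ±y, selected by the pair (a,b).
selected : ∀ {a b s t} → HalfPair a b s t → ℤ → ℤ → ℤ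
selected agree⁺  x y = x
selected agree⁻  x y = - x
selected differ⁺ x y = y
selected differ⁻ x y = - y

pick₁ : ∀ x y → 1ℤ *ᶻ x +ᶻ 0ℤ *ᶻ y ≡ x
pick₁ = solve-∀
pick₁⁻ : ∀ x y → -1ℤ *ᶻ x +ᶻ 0ℤ *ᶻ y ≡ - x
pick₁⁻ = solve-∀
pick₂ : ∀ x y → 0ℤ *ᶻ x +ᶻ 1ℤ *ᶻ y ≡ y
pick₂ = solve-∀
pick₂⁻ : ∀ x y → 0ℤ *ᶻ x +ᶻ -1ℤ *ᶻ y ≡ - y
pick₂⁻ = solve-∀

mix≡selected : ∀ {a b s t} (h : HalfPair a b s t) x y → s *ᶻ x +ᶻ t *ᶻ y ≡ selected h x y
mix≡selected agree⁺  = pick₁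
mix≡selected agree⁻  = pick₁⁻
mix≡selected differ⁺ = pick₂
mix≡selected differ⁻ = pick₂⁻

selected-ternary : ∀ {a b s t x y} (h : HalfPair a b s t) → IsTernary x → IsTernary y → IsTernary (selected h x y)
selected-ternary agree⁺  tx ty = tx
selected-ternary agree⁻  tx ty = IsTernary-neg tx
selected-ternary differ⁺ tx ty = ty
selected-ternary differ⁻ tx ty = IsTernary-neg ty

nonzero : ℤ → ℤ
nonzero x = Z.+ (if does (x Z.≟ 0ℤ) then 0 else 1)

nonzero-neg : ∀ x → nonzero (- x) ≡ nonzero x
nonzero-neg (Z.+ zero)    = refl
nonzero-neg (Z.+ suc n)   = refl
nonzero-neg (Z.-[1+ n ]) = refl

nonzero-selected : ∀ {a b s t} (h : HalfPair a b s t) x y →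
  nonzero (selected h x y) ≡ nonzero s *ᶻ nonzero x +ᶻ nonzero t *ᶻ nonzero y
nonzero-selected agree⁺  x y = sym (pick₁ (nonzero x) (nonzero y))
nonzero-selected agree⁻  x y = trans (nonzero-neg x) (sym (pick₁ (nonzero x) (nonzero y)))
nonzero-selected differ⁺ x y = sym (pick₂ (nonzero x) (nonzero y))
nonzero-selected differ⁻ x y = trans (nonzero-neg y) (sym (pick₂ (nonzero x) (nonzero y)))

nonzero-partition : ∀ {a b s t} → HalfPair a b s t → nonzero s +ᶻ nonzero t ≡ 1ℤ
nonzero-partition agree⁺  = refl
nonzero-partition agree⁻  = refl
nonzero-partition differ⁺ = refl
nonzero-partition differ⁻ = refl

count : ℕ → Seq∞ → ℤ
count n x = ∑ n (λ i → nonzero (x i))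

weight≡count : ∀ {n} (y : Seq n) → Z.+ weight y ≡ count n (ext y)
weight≡count {n} y = trans (countFin≡sumFin n _) (sumFin≡∑ n (λ i → cong nonzero (sym (ext-toℕ y i))))

count-rev : ∀ v x → count v (rev v x) ≡ count v x
count-rev v x = sym (∑-reverse v (λ j → nonzero (x j)))

module Mixed (g v : ℕ) .{{_ : NonZero g}} (a b S T X Y : Seq∞)
             (halves : ∀ i → i < g → HalfPair (a i) (b i) (S i) (T i)) where

  mixed : Seq∞
  mixed = kron g S X ⊞ kron g T Y

  mixed-block : ∀ j i → (i<g : i < g) → mixed (g * j + i) ≡ selected (halves i i<g) (X j) (Y j)
  mixed-block j i i<g = trans (cong₂ _+ᶻ_ (kron-block g S X j i i<g) (kron-block g T Y j i i<g))
                              (mix≡selected (halves i i<g) (X j) (Y j))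

  mixed-ternary : (∀ j → j < v → IsTernary (X j)) → (∀ j → j < v → IsTernary (Y j)) →
    (e : Seq (g * v)) → e ≈ₛ mixed → Ternary e
  mixed-ternary tX tY e e≈ t = subst IsTernary (sym (trans (e≈ t) (trans (cong mixed t≡) (mixed-block j i i<g))))
                                     (selected-ternary (halves i i<g) (tX j j<v) (tY j j<v))
    where
    d = block-decomp g v (toℕ t) (toℕ<n t)
    t≡ = proj₁ d
    i = toℕ t % g
    j = toℕ t / g
    i<g = proj₁ (proj₂ d)
    j<v = proj₂ (proj₂ d)

  mixed-weight : (e : Seq (g * v)) → e ≈ₛ mixed →
    Z.+ weight e ≡ count g S *ᶻ count v X +ᶻ count g T *ᶻ count v Y
  mixed-weight e e≈ = begin
      Z.+ weight e             ≡⟨ weight≡count e ⟩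
      count (g * v) (ext e)    ≡⟨ ∑-cong (g * v) (λ t p → cong nonzero (≈ₛ-ext {y = e} {Y = mixed} e≈ t p)) ⟩
      count (g * v) mixed      ≡⟨ ∑-blocks g v _ ⟩
      ∑ v (λ j → ∑ g (λ i → nonzero (mixed (g * j + i))))
        ≡⟨ ∑-cong v (λ j _ → ∑-cong g (λ i i<g →
             trans (cong nonzero (mixed-block j i i<g)) (nonzero-selected (halves i i<g) (X j) (Y j)))) ⟩
      ∑ v (λ j → ∑ g (λ i → nonzero (S i) *ᶻ nonzero (X j) +ᶻ nonzero (T i) *ᶻ nonzero (Y j)))
        ≡⟨ ∑∑-bilinear g v _ _ _ _ ⟩
      count g S *ᶻ count v X +ᶻ count g T *ᶻ count v Y ∎
    where open ≡-Reasoning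

  count-partition : count g S +ᶻ count g T ≡ Z.+ g
  count-partition = begin
      count g S +ᶻ count g T                       ≡⟨ sym (∑-+ g _ _) ⟩
      ∑ g (λ i → nonzero (S i) +ᶻ nonzero (T i))   ≡⟨ ∑-cong g (λ i p → nonzero-partition (halves i p)) ⟩
      ∑ g (λ _ → 1ℤ)                               ≡⟨ ∑-const g 1ℤ ⟩
      Z.+ g *ᶻ 1ℤ                                  ≡⟨ ZP.*-identityʳ _ ⟩
      Z.+ g                                        ∎
    where open ≡-Reasoning

count-neg : ∀ n x → count n (neg x) ≡ count n x
count-neg n x = ∑-cong n (λ i _ → nonzero-neg (x i))

-- The terms of corr (E,E) + corr (F,F) after expanding with corr-kron: the
-- cross terms cancel in pairs, leaving (aper_s + aper_t)(cc + dd) at lags Q, Q+1.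
cross-terms-cancel : ∀ (Ass Att Ast Ats Oss Ott Ost Ots cc dd x y cc' dd' x' y' : ℤ) →
  (((Ass *ᶻ cc +ᶻ Oss *ᶻ cc') +ᶻ (Ast *ᶻ x +ᶻ Ost *ᶻ x')) +ᶻ ((Ats *ᶻ y +ᶻ Ots *ᶻ y') +ᶻ (Att *ᶻ dd +ᶻ Ott *ᶻ dd')))
  +ᶻ (((Ass *ᶻ dd +ᶻ Oss *ᶻ dd') +ᶻ ((- Ast) *ᶻ x +ᶻ (- Ost) *ᶻ x'))
      +ᶻ (((- Ats) *ᶻ y +ᶻ (- Ots) *ᶻ y') +ᶻ (Att *ᶻ cc +ᶻ Ott *ᶻ cc')))
  ≡ (Ass +ᶻ Att) *ᶻ (cc +ᶻ dd) +ᶻ (Oss +ᶻ Ott) *ᶻ (cc' +ᶻ dd')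
cross-terms-cancel = solve-∀

positive-block : ∀ g Q → 0 < g * Q + 0 → 0 < Q
positive-block g (suc Q) _ = s≤s z≤n
positive-block g zero    p = ⊥-elim (NP.<-irrefl (sym (trans (NP.+-identityʳ (g * 0)) (NP.*-zeroʳ g))) p)

module Construction (g v : ℕ) .{{_ : NonZero g}} (a b : Seq g) (ha : Binary a) (hb : Binary b)
                    (golay : ∀ k → 1 ≤ k → AF a k +ᶻ AF b k ≡ 0ℤ)
                    (c d : Seq v) (hc : Ternary c) (hd : Ternary d) where
  open GolayHalves a b ha hb

  cN dN : Seq∞
  cN = ext c
  dN = ext d

  -- e_{gj+i} = s_i c_j + t_i d_{v-1-j}  and  f_{gj+i} = s_i d_j - t_i c_{v-1-j}.
  module E = Mixed g v aN bN sN tN cN (rev v dN) halves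
  module F = Mixed g v bN aN sN (neg tN) dN (rev v cN) (λ i p → HalfPair-swap (halves i p))

  e≈ : seqE a b c d ≈ₛ E.mixed
  e≈ t = cong₂ _+ᶻ_ (polyZg≈kron g v (hsum a b) c t) (polyZmg≈kron g v (hdiff a b) d t)

  f≈ : seqF a b c d ≈ₛ F.mixed
  f≈ t = trans (ZP.+-comm (polyZmg (hdiff' a b) c t) _) (cong₂ _+ᶻ_ (polyZg≈kron g v (hsum a b) d t)
    (trans (polyZmg≈kron g v (hdiff' a b) c t) (cong (_*ᶻ rev v cN (toℕ t / g)) (hdiff'≡neg (toℕ t % g)))))

  ternary-e : Ternary (seqE a b c d)
  ternary-e = E.mixed-ternary (ext-ternary c hc) (λ j p → ext-ternary d hd (v ∸ suc j) (reflect-< p)) _ e≈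

  ternary-f : Ternary (seqF a b c d)
  ternary-f = F.mixed-ternary (ext-ternary d hd) (λ j p → ext-ternary c hc (v ∸ suc j) (reflect-< p)) _ f≈

  weight-sum : ∀ w → weight c + weight d ≡ w → weight (seqE a b c d) + weight (seqF a b c d) ≡ g * w
  weight-sum w wt = ZP.+-injective (begin
      Z.+ (weight (seqE a b c d) + weight (seqF a b c d))
        ≡⟨ ZP.pos-+ (weight (seqE a b c d)) _ ⟩
      Z.+ weight (seqE a b c d) +ᶻ Z.+ weight (seqF a b c d)
        ≡⟨ cong₂ _+ᶻ_ (E.mixed-weight _ e≈) (F.mixed-weight _ f≈) ⟩
      (ns *ᶻ count v cN +ᶻ nt *ᶻ count v (rev v dN)) +ᶻ (ns *ᶻ count v dN +ᶻ count g (neg tN) *ᶻ count v (rev v cN))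
        ≡⟨ cong₂ (λ p q → (ns *ᶻ count v cN +ᶻ nt *ᶻ p) +ᶻ (ns *ᶻ count v dN +ᶻ q)) (count-rev v dN)
                 (cong₂ _*ᶻ_ (count-neg g tN) (count-rev v cN)) ⟩
      (ns *ᶻ count v cN +ᶻ nt *ᶻ count v dN) +ᶻ (ns *ᶻ count v dN +ᶻ nt *ᶻ count v cN)
        ≡⟨ regroup ns nt (count v cN) (count v dN) ⟩
      (ns +ᶻ nt) *ᶻ (count v cN +ᶻ count v dN)
        ≡⟨ cong₂ _*ᶻ_ E.count-partition (sym (cong₂ _+ᶻ_ (weight≡count c) (weight≡count d))) ⟩
      Z.+ g *ᶻ (Z.+ weight c +ᶻ Z.+ weight d)
        ≡⟨ cong (Z.+ g *ᶻ_) (trans (sym (ZP.pos-+ (weight c) (weight d))) (cong Z.+_ wt)) ⟩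
      Z.+ g *ᶻ Z.+ w
        ≡⟨ sym (ZP.pos-* g w) ⟩
      Z.+ (g * w) ∎)
    where
    open ≡-Reasoning
    ns = count g sN
    nt = count g tN
    regroup : ∀ a b x y → (a *ᶻ x +ᶻ b *ᶻ y) +ᶻ (a *ᶻ y +ᶻ b *ᶻ x) ≡ (a +ᶻ b) *ᶻ (x +ᶻ y)
    regroup = solve-∀

  module Complementarity (ε : ℤ) where

    cc dd x y : ℕ → ℤ
    cc = corr ε v cN cN
    dd = corr ε v dN dN
    x  = corr ε v cN (rev v dN)
    y  = corr ε v (rev v dN) cN

    module AtLag (Q r : ℕ) (Q<v : Q < v) (r<g : r < g) where
      Ass Att Ast Ats Oss Ott Ost Ots : ℤ
      Ass = aper g sN sN r
      Att = aper g tN tN r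
      Ast = aper g sN tN r
      Ats = aper g tN sN r
      Oss = overflow g sN sN r
      Ott = overflow g tN tN r
      Ost = overflow g sN tN r
      Ots = overflow g tN sN r

      kron-term : ∀ X Y X' Y' {α α'} (P : ℕ → ℤ) → aper g X X' r ≡ α → overflow g X X' r ≡ α' →
        (∀ q → q ≤ v → corr ε v Y Y' q ≡ P q) →
        corr ε (g * v) (kron g X Y) (kron g X' Y') (g * Q + r) ≡ α *ᶻ P Q +ᶻ α' *ᶻ P (suc Q)
      kron-term X Y X' Y' P refl refl hP = trans (corr-kron ε g v X Y X' Y' Q r r<g)
        (cong₂ _+ᶻ_ (cong (aper g X X' r *ᶻ_) (hP Q (NP.<⇒≤ Q<v)))
                    (cong (overflow g X X' r *ᶻ_) (hP (suc Q) Q<v)))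

      corr-E : corr ε (g * v) E.mixed E.mixed (g * Q + r) ≡
        ((Ass *ᶻ cc Q +ᶻ Oss *ᶻ cc (suc Q)) +ᶻ (Ast *ᶻ x Q +ᶻ Ost *ᶻ x (suc Q)))
        +ᶻ ((Ats *ᶻ y Q +ᶻ Ots *ᶻ y (suc Q)) +ᶻ (Att *ᶻ dd Q +ᶻ Ott *ᶻ dd (suc Q)))
      corr-E = trans (corr-⊞ ε (g * v) (kron g sN cN) (kron g tN (rev v dN)) (g * Q + r))
        (cong₂ _+ᶻ_ (cong₂ _+ᶻ_ (kron-term sN cN sN cN cc refl refl (λ _ _ → refl))
                                (kron-term sN cN tN (rev v dN) x refl refl (λ _ _ → refl)))
                    (cong₂ _+ᶻ_ (kron-term tN (rev v dN) sN cN y refl refl (λ _ _ → refl))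
                                (kron-term tN (rev v dN) tN (rev v dN) dd refl refl
                                           (λ q q≤v → corr-rev-rev ε v q dN q≤v))))

      corr-F : corr ε (g * v) F.mixed F.mixed (g * Q + r) ≡
        ((Ass *ᶻ dd Q +ᶻ Oss *ᶻ dd (suc Q)) +ᶻ ((- Ast) *ᶻ x Q +ᶻ (- Ost) *ᶻ x (suc Q)))
        +ᶻ (((- Ats) *ᶻ y Q +ᶻ (- Ots) *ᶻ y (suc Q)) +ᶻ (Att *ᶻ cc Q +ᶻ Ott *ᶻ cc (suc Q)))
      corr-F = trans (corr-⊞ ε (g * v) (kron g sN dN) (kron g (neg tN) (rev v cN)) (g * Q + r))
        (cong₂ _+ᶻ_
          (cong₂ _+ᶻ_ (kron-term sN dN sN dN dd refl refl (λ _ _ → refl))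
                      (kron-term sN dN (neg tN) (rev v cN) x (aper-negʳ g sN tN r) (overflow-negʳ g sN tN r)
                                   (λ q q≤v → corr-rev-swap ε v q dN cN q≤v)))
          (cong₂ _+ᶻ_ (kron-term (neg tN) (rev v cN) sN dN y (aper-negˡ g tN sN r) (overflow-negˡ g tN sN r)
                                   (λ q q≤v → corr-revˡ ε v q cN dN q≤v))
                      (kron-term (neg tN) (rev v cN) (neg tN) (rev v cN) cc aper-neg-neg overflow-neg-neg 
                                 (λ q q≤v → corr-rev-rev ε v q cN q≤v))))
        where
        aper-neg-neg : aper g (neg tN) (neg tN) r ≡ Att
        aper-neg-neg = trans (aper-negˡ g tN (neg tN) r)
                             (trans (cong -_ (aper-negʳ g tN tN r)) (ZP.neg-involutive _))
        overflow-neg-neg : overflow g (neg tN) (neg tN) r ≡ Ott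
        overflow-neg-neg = trans (overflow-negˡ g tN (neg tN) r)
                                 (trans (cong -_ (overflow-negʳ g tN tN r)) (ZP.neg-involutive _))

      corr-E+F : corr ε (g * v) E.mixed E.mixed (g * Q + r) +ᶻ corr ε (g * v) F.mixed F.mixed (g * Q + r)
        ≡ (Ass +ᶻ Att) *ᶻ (cc Q +ᶻ dd Q) +ᶻ (Oss +ᶻ Ott) *ᶻ (cc (suc Q) +ᶻ dd (suc Q))
      corr-E+F = trans (cong₂ _+ᶻ_ corr-E corr-F)
        (cross-terms-cancel Ass Att Ast Ats Oss Ott Ost Ots
                            (cc Q) (dd Q) (x Q) (y Q) (cc (suc Q)) (dd (suc Q)) (x (suc Q)) (y (suc Q)))

    -- The lag-Q term vanishes: by the Golay property if r > 0, by the hypothesis on (c,d) if r = 0.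
    aligned-term-vanishes : ComplementaryCorr ε v cN dN → ∀ Q r → Q < v → 0 < g * Q + r →
      (aper g sN sN r +ᶻ aper g tN tN r) *ᶻ (cc Q +ᶻ dd Q) ≡ 0ℤ
    aligned-term-vanishes hyp Q (suc r) Q<v _ =
      trans (cong (_*ᶻ (cc Q +ᶻ dd Q)) (aper-halves-vanish golay (suc r) (s≤s z≤n))) (ZP.*-zeroˡ (cc Q +ᶻ dd Q))
    aligned-term-vanishes hyp Q zero Q<v pos =
      trans (cong ((aper g sN sN 0 +ᶻ aper g tN tN 0) *ᶻ_) (hyp Q (positive-block g Q pos) Q<v))
            (ZP.*-zeroʳ (aper g sN sN 0 +ᶻ aper g tN tN 0))

    complementary : ComplementaryCorr ε v cN dN → ComplementaryCorr ε (g * v) E.mixed F.mixed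
    complementary hyp K 0<K K<N = begin
        corr ε (g * v) E.mixed E.mixed K +ᶻ corr ε (g * v) F.mixed F.mixed K
          ≡⟨ cong (λ z → corr ε (g * v) E.mixed E.mixed z +ᶻ corr ε (g * v) F.mixed F.mixed z) K≡ ⟩
        corr ε (g * v) E.mixed E.mixed (g * Q + r) +ᶻ corr ε (g * v) F.mixed F.mixed (g * Q + r)
          ≡⟨ AtLag.corr-E+F Q r Q<v r<g ⟩
        (aper g sN sN r +ᶻ aper g tN tN r) *ᶻ (cc Q +ᶻ dd Q)
          +ᶻ (overflow g sN sN r +ᶻ overflow g tN tN r) *ᶻ (cc (suc Q) +ᶻ dd (suc Q))
          ≡⟨ cong₂ _+ᶻ_ (aligned-term-vanishes hyp Q r Q<v (subst (0 <_) K≡ 0<K))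
                        (trans (cong (_*ᶻ (cc (suc Q) +ᶻ dd (suc Q))) (overflow-halves-vanish golay r r<g))
                               (ZP.*-zeroˡ (cc (suc Q) +ᶻ dd (suc Q)))) ⟩
        0ℤ +ᶻ 0ℤ
          ≡⟨⟩
        0ℤ ∎
      where
      open ≡-Reasoning
      blocks = block-decomp g v K K<N
      Q = K / g
      r = K % g
      K≡ = proj₁ blocks
      r<g = proj₁ (proj₂ blocks)
      Q<v = proj₂ (proj₂ blocks)

  complementary-pair : ∀ ε → ε *ᶻ ε ≡ 1ℤ → (M : ∀ n → Mat n) → IsShift ε M →
    ComplementaryMat (M v) c d → ComplementaryMat (M (g * v)) (seqE a b c d) (seqF a b c d)
  complementary-pair ε εε M isM hyp =
    corr⇒complementary ε εε M isM (seqE a b c d) (seqF a b c d) λ K 0<K K<N →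
      trans (cong₂ _+ᶻ_ (on-mixed (seqE a b c d) E.mixed e≈ K K<N) (on-mixed (seqF a b c d) F.mixed f≈ K K<N))
            (Complementarity.complementary ε (complementary⇒corr ε εε M isM c d hyp) K 0<K K<N)
    where
    on-mixed : (z : Seq (g * v)) (Z : Seq∞) → z ≈ₛ Z → ∀ K → K < g * v →
      corr ε (g * v) (ext z) (ext z) K ≡ corr ε (g * v) Z Z K
    on-mixed z Z z≈ K K<N = corr-cong ε (g * v) K (NP.<⇒≤ K<N) (≈ₛ-ext {y = z} {Y = Z} z≈) (≈ₛ-ext {y = z} {Y = Z} z≈)

-- The proposition: g ≥ 1 makes the block decomposition available, and the
-- periodic and negaperiodic cases are the shift matrices with corner 1 and -1.
proposition3 : (g v w : ℕ) → 1 ≤ g → 1 ≤ v →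
    (a b : Seq g) → GolayPair a b →
    (c d : Seq v) → Ternary c → Ternary d →
    Ternary (seqE a b c d) × Ternary (seqF a b c d) ×
    (PeriodicCTP c d w → PeriodicCTP (seqE a b c d) (seqF a b c d) (g * w)) ×
    (NegaperiodicCTP c d w → NegaperiodicCTP (seqE a b c d) (seqF a b c d) (g * w))
proposition3 g@(suc _) v w _ _ a b (ha , hb , golay) c d hc hd =
  ternary-e , ternary-f , periodic , negaperiodic
  where
  open Construction g v a b ha hb golay c d hc hd
  periodic : PeriodicCTP c d w → PeriodicCTP (seqE a b c d) (seqF a b c d) (g * w)
  periodic (_ , _ , comp , wt) =
    ternary-e , ternary-f , complementary-pair 1ℤ refl Pmat (λ _ _ _ → refl) comp , weight-sum w wt
  negaperiodic : NegaperiodicCTP c d w → NegaperiodicCTP (seqE a b c d) (seqF a b c d) (g * w)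
  negaperiodic (_ , _ , comp , wt) =
    ternary-e , ternary-f , complementary-pair -1ℤ refl Nmat (λ _ _ _ → refl) comp , weight-sum w wt
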